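{- If $\mathcal{D}_h$ is a sound abstraction of $\mathcal{D}_l$ relative to a refinement mapping $m$, then for any sequence of ground high-level actions $\vec\alpha$ and any ground high-level action $\beta$: $\mathcal{D}_l\cup\mathcal{C}\models\exists s.\,Do(m(\vec\alpha\beta),S_0,s)\supset(\forall s.\,Do(m(\vec\alpha),S_0,s)\supset\exists s'.\,Do(m(\beta),s,s'))$, where $\vec\alpha\beta$ is the sequence $\vec\alpha$ followed by $\beta$.
   Context: Situation calculus setting. Objects are a countably infinite set $\mathcal{N}$ of standard names (unique names and domain closure); no function symbols other than constants; no non-fluent predicates. Situations: $S_0$ and $do(a,s)$; $do([a_1,\dots,a_n],s)$ abbreviates $do(a_n,\dots,do(a_1,s)\dots)$, also written $do(\vec a,s)$. $Poss(a,s)$ means $a$ is executable in $s$; $Executable(s)$ means every action along the history from $S_0$ to $s$ was possible where performed. A basic action theory (BAT) over finitely many action types $\mathcal{A}$ and fluents $\mathcal{F}$ consists of initial-state axioms $\mathcal{D}_{S_0}$, precondition axioms $Poss(A(\vec x),s)\equiv\phi^{Poss}_A(\vec x,s)$, successor state axioms $F(\vec x,do(a,s))\equiv\phi^{ssa}_F(\vec x,a,s)$ (right-hand sides uniform in $s$), unique names/domain closure axioms for actions $\mathcal{D}_{ca}$ and for objects $\mathcal{D}_{coa}$, and foundational axioms $\Sigma$. A situation-suppressed formula omits situation arguments of fluents; $\phi[s]$ restores $s$. ConGolog programs $\delta::=\alpha\mid\varphi?\mid\delta_1;\delta_2\mid\delta_1|\delta_2\mid\pi x.\delta\mid\delta^*\mid\delta_1\|\delta_2$,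 $nil=True?$; $\mathcal{C}$ are the axioms: $Trans(\alpha,s,\delta',s')\equiv s'=do(\alpha,s)\land Poss(\alpha,s)\land\delta'=True?$; $Trans(\varphi?,s,\delta',s')\equiv False$; $Trans(\delta_1;\delta_2,s,\delta',s')\equiv\exists\delta_1'(Trans(\delta_1,s,\delta_1',s')\land\delta'=\delta_1';\delta_2)\lor(Final(\delta_1,s)\land Trans(\delta_2,s,\delta',s'))$; $Trans(\delta_1|\delta_2,\cdot)\equiv Trans(\delta_1,\cdot)\lor Trans(\delta_2,\cdot)$; $Trans(\pi x.\delta,s,\delta',s')\equiv\exists x.Trans(\delta,s,\delta',s')$; $Trans(\delta^*,s,\delta',s')\equiv\exists\delta''(Trans(\delta,s,\delta'',s')\land\delta'=\delta'';\delta^*)$; $Trans(\delta_1\|\delta_2,s,\delta',s')\equiv\exists\delta_1'(Trans(\delta_1,s,\delta_1',s')\land\delta'=\delta_1'\|\delta_2)\lor\exists\delta_2'(Trans(\delta_2,s,\delta_2',s')\land\delta'=\delta_1\|\delta_2')$; $Final(\alpha,s)\equiv False$; $Final(\varphi?,s)\equiv\varphi[s]$; $Final(\delta_1;\delta_2,s)\equiv Final(\delta_1,s)\land Final(\delta_2,s)$; $Final(\delta_1|\delta_2,s)\equiv Final(\delta_1,s)\lor Final(\delta_2,s)$; $Final(\pi x.\delta,s)\equiv\exists x.Final(\delta,s)$; $Final(\delta^*,s)\equiv True$; $Final(\delta_1\|\delta_2,s)\equiv Final(\delta_1,s)\land Final(\delta_2,s)$. $Do(\delta,s,s')\doteq\exists\delta'.Trans^*(\delta,s,\delta',s')\land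 Final(\delta',s')$, $Trans^*$ the reflexive transitive closure. $\mathcal{D}_h$ (high-level) and $\mathcal{D}_l$ (low-level) are BATs with action types $\mathcal{A}_h,\mathcal{A}_l$ and fluents $\mathcal{F}_h,\mathcal{F}_l$, sharing only $\mathcal{N}$. A refinement mapping $m$ maps each $A\in\mathcal{A}_h$ to a situation-determined ConGolog program $m(A(\vec x))$ over $\mathcal{D}_l$ with free variables $\vec x$, and each $F\in\mathcal{F}_h$ to a situation-suppressed low-level formula $m(F(\vec x))$; $m(\phi)$ substitutes $m(F(\vec x))$ for fluent atoms; $m(\alpha_1,\dots,\alpha_n)=m(\alpha_1);\dots;m(\alpha_n)$, $m(\epsilon)=nil$. For a model $M_h$ of $\mathcal{D}_h$ and a model $M_l$ of $\mathcal{D}_l\cup\mathcal{C}$: $s_h\simeq_m^{M_h,M_l}s_l$ iff for all $F\in\mathcal{F}_h$ and assignments $v$, $M_h,v[s/s_h]\models F(\vec x,s)$ iff $M_l,v[s/s_l]\models m(F(\vec x))[s]$. A relation $B$ between situation domains is an $m$-bisimulation if each $\langle s_h,s_l\rangle\in B$ satisfies: (1) $s_h\simeq_m^{M_h,M_l}s_l$; (2) for each $A\in\mathcal{A}_h$ and $v$, if some $s_h'$ has $M_h,v[s/s_h,s'/s_h']\models Poss(A(\vec x),s)\land s'=do(A(\vec x),s)$ then some $s_l'$ has $M_l,v[s/s_l,s'/s_l']\models Do(m(A(\vec x)),s,s')$ and $\langle s_h',s_l'\rangle\in B$; (3) conversely, if some $s_l'$ has $M_l,v[s/s_l,s'/s_l']\models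 Do(m(A(\vec x)),s,s')$ then some $s_h'$ has $M_h,v[s/s_h,s'/s_h']\models Poss(A(\vec x),s)\land s'=do(A(\vec x),s)$ and $\langle s_h',s_l'\rangle\in B$. $M_h\sim_m M_l$ iff some $m$-bisimulation contains $\langle S_0^{M_h},S_0^{M_l}\rangle$. $\mathcal{D}_h$ is a sound abstraction of $\mathcal{D}_l$ relative to $m$ iff for every model $M_l$ of $\mathcal{D}_l\cup\mathcal{C}$ there is a model $M_h$ of $\mathcal{D}_h$ with $M_h\sim_m M_l$. -}

module Defs where

open import Data.Nat using (ℕ; zero; suc)
open import Data.Fin using (Fin; zero; suc)
open import Data.Vec using (Vec; []; _∷_; lookup)
import Data.Vec as Vec
open import Data.List using (List; []; _∷_)
open import Data.Product using (Σ; _×_; _,_)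
open import Data.Sum using (_⊎_)
open import Data.Empty using (⊥)
open import Data.Unit using (⊤)
open import Relation.Binary.PropositionalEquality using (_≡_)
open import Relation.Binary.Construct.Closure.ReflexiveTransitive using (Star)
open import Function.Bundles using (_⇔_)

-- Signatures: finitely many action types and fluents, each with an arity.
-- Objects are the standard names ℕ (unique names + domain closure).

record Sig : Set where
  field
    nAct  : ℕ
    actAr : Fin nAct → ℕ
    nFl   : ℕ
    flAr  : Fin nFl → ℕ
open Sig public

-- Ground actions A(n₁,…,nₖ) (unique names + domain closure for actions).
Action : Sig → Set
Action S = Σ (Fin (nAct S)) (λ A → Vec ℕ (actAr S A))

-- Situations: S₀ and do(a,s) (models of Σ are isomorphic to this tree of
-- action histories).
data Sit (S : Sig) : Set where
  S₀  : Sit S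
  doₛ : Action S → Sit S → Sit S

-- Situation-suppressed formulas with n object variables and k action
-- variables in scope (de Bruijn, via Fin).

data ObjTerm (n : ℕ) : Set where
  var : Fin n → ObjTerm n
  nm  : ℕ → ObjTerm n

data ActTerm (S : Sig) (n k : ℕ) : Set where
  avar : Fin k → ActTerm S n k
  act  : (A : Fin (nAct S)) → Vec (ObjTerm n) (actAr S A) → ActTerm S n k

data Formula (S : Sig) : ℕ → ℕ → Set where
  true false : ∀ {n k} → Formula S n k
  fl   : ∀ {n k} (F : Fin (nFl S)) → Vec (ObjTerm n) (flAr S F) → Formula S n k
  _=ₒ_ : ∀ {n k} → ObjTerm n → ObjTerm n → Formula S n k
  _=ₐ_ : ∀ {n k} → ActTerm S n k → ActTerm S n k → Formula S n k
  ¬f   : ∀ {n k} → Formula S n k → Formula S n k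
  _∧f_ _∨f_ _⇒f_ : ∀ {n k} → Formula S n k → Formula S n k → Formula S n k
  ∀o ∃o : ∀ {n k} → Formula S (suc n) k → Formula S n k
  ∀a ∃a : ∀ {n k} → Formula S n (suc k) → Formula S n k

record Interp (S : Sig) : Set₁ where
  field
    Fl   : (F : Fin (nFl S)) → Vec ℕ (flAr S F) → Sit S → Set
    Poss : Action S → Sit S → Set
open Interp public

evalO : ∀ {n} → (Fin n → ℕ) → ObjTerm n → ℕ
evalO ρ (var i) = ρ i
evalO ρ (nm x)  = x

evalA : ∀ {S n k} → (Fin n → ℕ) → (Fin k → Action S) → ActTerm S n k → Action S
evalA ρ α (avar i)  = α i
evalA ρ α (act A t) = A , Vec.map (evalO ρ) t

ext : ∀ {A : Set} {n} → A → (Fin n → A) → Fin (suc n) → A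
ext x ρ zero    = x
ext x ρ (suc i) = ρ i

eval : ∀ {S n k} → Interp S → Formula S n k → (Fin n → ℕ) → (Fin k → Action S) → Sit S → Set
eval I true      ρ α s = ⊤
eval I false     ρ α s = ⊥
eval I (fl F t)  ρ α s = Fl I F (Vec.map (evalO ρ) t) s
eval I (x =ₒ y)  ρ α s = evalO ρ x ≡ evalO ρ y
eval I (x =ₐ y)  ρ α s = evalA ρ α x ≡ evalA ρ α y
eval I (¬f φ)    ρ α s = eval I φ ρ α s → ⊥
eval I (φ ∧f ψ)  ρ α s = eval I φ ρ α s × eval I ψ ρ α s
eval I (φ ∨f ψ)  ρ α s = eval I φ ρ α s ⊎ eval I ψ ρ α s
eval I (φ ⇒f ψ)  ρ α s = eval I φ ρ α s → eval I ψ ρ α s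
eval I (∀o φ)    ρ α s = (x : ℕ) → eval I φ (ext x ρ) α s
eval I (∃o φ)    ρ α s = Σ ℕ (λ x → eval I φ (ext x ρ) α s)
eval {S} I (∀a φ) ρ α s = (a : Action S) → eval I φ ρ (ext a α) s
eval {S} I (∃a φ) ρ α s = Σ (Action S) (λ a → eval I φ ρ (ext a α) s)

noVar : ∀ {A : Set} → Fin 0 → A
noVar ()

record BAT (S : Sig) : Set₁ where
  field
    init : Formula S 0 0 → Set
    poss : (A : Fin (nAct S)) → Formula S (actAr S A) 0
    ssa  : (F : Fin (nFl S)) → Formula S (flAr S F) 1     -- φ^ssa_F(x⃗,a), a = action var 0
open BAT public

record IsModel {S : Sig} (D : BAT S) (I : Interp S) : Set₁ where
  field
    initOK : ∀ φ → init D φ → eval I φ noVar noVar S₀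
    possOK : ∀ A (x : Vec ℕ (actAr S A)) (s : Sit S) →
             Poss I (A , x) s ⇔ eval I (poss D A) (lookup x) noVar s
    ssaOK  : ∀ F (x : Vec ℕ (flAr S F)) (a : Action S) (s : Sit S) →
             Fl I F x (doₛ a s) ⇔ eval I (ssa D F) (lookup x) (ext a noVar) s

data Prog (S : Sig) (n : ℕ) : Set where
  act    : ActTerm S n 0 → Prog S n
  test   : Formula S n 0 → Prog S n
  _︔_    : Prog S n → Prog S n → Prog S n
  _∣_    : Prog S n → Prog S n → Prog S n
  π      : Prog S (suc n) → Prog S n
  _*     : Prog S n → Prog S n
  _∥_    : Prog S n → Prog S n → Prog S n

nil : ∀ {S n} → Prog S n
nil = test true

liftσ : ∀ {n m} → (Fin n → ObjTerm m) → Fin (suc n) → ObjTerm (suc m)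
liftσ σ zero    = var zero
liftσ σ (suc i) with σ i
... | var j = var (suc j)
... | nm x  = nm x

subO : ∀ {n m} → (Fin n → ObjTerm m) → ObjTerm n → ObjTerm m
subO σ (var i) = σ i
subO σ (nm x)  = nm x

subA : ∀ {S n m k} → (Fin n → ObjTerm m) → ActTerm S n k → ActTerm S m k
subA σ (avar i)  = avar i
subA σ (act A t) = act A (Vec.map (subO σ) t)

subF : ∀ {S n m k} → (Fin n → ObjTerm m) → Formula S n k → Formula S m k
subF σ true     = true
subF σ false    = false
subF σ (fl F t) = fl F (Vec.map (subO σ) t)
subF σ (x =ₒ y) = subO σ x =ₒ subO σ y
subF σ (x =ₐ y) = subA σ x =ₐ subA σ y
subF σ (¬f φ)   = ¬f (subF σ φ)
subF σ (φ ∧f ψ) = subF σ φ ∧f subF σ ψ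
subF σ (φ ∨f ψ) = subF σ φ ∨f subF σ ψ
subF σ (φ ⇒f ψ) = subF σ φ ⇒f subF σ ψ
subF σ (∀o φ)   = ∀o (subF (liftσ σ) φ)
subF σ (∃o φ)   = ∃o (subF (liftσ σ) φ)
subF σ (∀a φ)   = ∀a (subF σ φ)
subF σ (∃a φ)   = ∃a (subF σ φ)

subP : ∀ {S n m} → (Fin n → ObjTerm m) → Prog S n → Prog S m
subP σ (act t)  = act (subA σ t)
subP σ (test φ) = test (subF σ φ)
subP σ (δ ︔ γ)  = subP σ δ ︔ subP σ γ
subP σ (δ ∣ γ)  = subP σ δ ∣ subP σ γ
subP σ (π δ)    = π (subP (liftσ σ) δ)
subP σ (δ *)    = subP σ δ *
subP σ (δ ∥ γ)  = subP σ δ ∥ subP σ γ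

inst1 : ∀ {S} → Prog S 1 → ℕ → Prog S 0
inst1 δ x = subP (λ _ → nm x) δ

inst : ∀ {S n} → Prog S n → Vec ℕ n → Prog S 0
inst δ xs = subP (λ i → nm (lookup xs i)) δ

-- The axioms C (Trans / Final), for ground programs, in a model I.

module Semantics {S : Sig} (I : Interp S) where

  data Final : Prog S 0 → Sit S → Set where
    f-test : ∀ {φ s} → eval I φ noVar noVar s → Final (test φ) s
    f-seq  : ∀ {δ₁ δ₂ s} → Final δ₁ s → Final δ₂ s → Final (δ₁ ︔ δ₂) s
    f-chl  : ∀ {δ₁ δ₂ s} → Final δ₁ s → Final (δ₁ ∣ δ₂) s
    f-chr  : ∀ {δ₁ δ₂ s} → Final δ₂ s → Final (δ₁ ∣ δ₂) s
    f-pi   : ∀ {δ s} (x : ℕ) → Final (inst1 δ x) s → Final (π δ) s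
    f-star : ∀ {δ s} → Final (δ *) s
    f-conc : ∀ {δ₁ δ₂ s} → Final δ₁ s → Final δ₂ s → Final (δ₁ ∥ δ₂) s

  data Trans : Prog S 0 → Sit S → Prog S 0 → Sit S → Set where
    t-act   : ∀ {t s} → Poss I (evalA noVar noVar t) s →
              Trans (act t) s nil (doₛ (evalA noVar noVar t) s)
    t-seq₁  : ∀ {δ₁ δ₁' δ₂ s s'} → Trans δ₁ s δ₁' s' → Trans (δ₁ ︔ δ₂) s (δ₁' ︔ δ₂) s'
    t-seq₂  : ∀ {δ₁ δ₂ δ' s s'} → Final δ₁ s → Trans δ₂ s δ' s' → Trans (δ₁ ︔ δ₂) s δ' s'
    t-chl   : ∀ {δ₁ δ₂ δ' s s'} → Trans δ₁ s δ' s' → Trans (δ₁ ∣ δ₂) s δ' s'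
    t-chr   : ∀ {δ₁ δ₂ δ' s s'} → Trans δ₂ s δ' s' → Trans (δ₁ ∣ δ₂) s δ' s'
    t-pi    : ∀ {δ δ' s s'} (x : ℕ) → Trans (inst1 δ x) s δ' s' → Trans (π δ) s δ' s'
    t-star  : ∀ {δ δ'' s s'} → Trans δ s δ'' s' → Trans (δ *) s (δ'' ︔ (δ *)) s'
    t-concl : ∀ {δ₁ δ₁' δ₂ s s'} → Trans δ₁ s δ₁' s' → Trans (δ₁ ∥ δ₂) s (δ₁' ∥ δ₂) s'
    t-concr : ∀ {δ₁ δ₂ δ₂' s s'} → Trans δ₂ s δ₂' s' → Trans (δ₁ ∥ δ₂) s (δ₁ ∥ δ₂') s'

  Config : Set
  Config = Prog S 0 × Sit S

  Step : Config → Config → Set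
  Step (δ , s) (δ' , s') = Trans δ s δ' s'

  Trans* : Prog S 0 → Sit S → Prog S 0 → Sit S → Set
  Trans* δ s δ' s' = Star Step (δ , s) (δ' , s')

  Do : Prog S 0 → Sit S → Sit S → Set
  Do δ s s' = Σ (Prog S 0) (λ δ' → Trans* δ s δ' s' × Final δ' s')

  SitDetermined : Prog S 0 → Sit S → Set
  SitDetermined δ s = ∀ {s' δ' δ''} → Trans* δ s δ' s' → Trans* δ s δ'' s' → δ' ≡ δ''

open Semantics public

record RefMap {Sh Sl : Sig} (Dl : BAT Sl) : Set₁ where
  field
    mA : (A : Fin (nAct Sh)) → Prog Sl (actAr Sh A)
    mF : (F : Fin (nFl Sh)) → Formula Sl (flAr Sh F) 0
    situationDetermined :
      ∀ (Il : Interp Sl) → IsModel Dl Il →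
      ∀ A (x : Vec ℕ (actAr Sh A)) (s : Sit Sl) → SitDetermined Il (inst (mA A) x) s
open RefMap public

module _ {Sh Sl : Sig} {Dl : BAT Sl} (m : RefMap {Sh} {Sl} Dl) where

  mAct : Action Sh → Prog Sl 0
  mAct (A , x) = inst (mA m A) x

  mSeq : List (Action Sh) → Prog Sl 0
  mSeq []           = nil
  mSeq (α ∷ [])     = mAct α
  mSeq (α ∷ β ∷ αs) = mAct α ︔ mSeq (β ∷ αs)

  Agree : Interp Sh → Interp Sl → Sit Sh → Sit Sl → Set
  Agree Ih Il sh sl = ∀ F (x : Vec ℕ (flAr Sh F)) →
    Fl Ih F x sh ⇔ eval Il (mF m F) (lookup x) noVar sl

  IsBisim : Interp Sh → Interp Sl → (Sit Sh → Sit Sl → Set) → Set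
  IsBisim Ih Il B = ∀ sh sl → B sh sl →
      Agree Ih Il sh sl
    × (∀ A (x : Vec ℕ (actAr Sh A)) → Poss Ih (A , x) sh →
         Σ (Sit Sl) (λ sl' → Do Il (inst (mA m A) x) sl sl' × B (doₛ (A , x) sh) sl'))
    × (∀ A (x : Vec ℕ (actAr Sh A)) (sl' : Sit Sl) → Do Il (inst (mA m A) x) sl sl' →
         Poss Ih (A , x) sh × B (doₛ (A , x) sh) sl')

  Bisimilar : Interp Sh → Interp Sl → Set₁
  Bisimilar Ih Il = Σ (Sit Sh → Sit Sl → Set) (λ B → IsBisim Ih Il B × B S₀ S₀)

  SoundAbstraction : BAT Sh → Set₁
  SoundAbstraction Dh = ∀ (Il : Interp Sl) → IsModel Dl Il →
    Σ (Interp Sh) (λ Ih → IsModel Dh Ih × Bisimilar Ih Il)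

module Submission where

-- Fix a high-level model Mₕ and an m-bisimulation B with Mₗ given by soundness.
-- Clause (3) shows that every execution of m(α⃗) from S₀, and the α⃗-prefix of
-- every execution of m(α⃗β), ends in a situation B-related to do(α⃗,S₀); the
-- latter run also shows that β is possible in do(α⃗,S₀). Clause (2) then yields
-- an execution of m(β) from every low-level situation related to do(α⃗,S₀), in
-- particular from the end s of any execution of m(α⃗).

open import Defs
open import Data.List using (List; _∷_; []; _++_)
open import Data.Product using (Σ; _,_; _×_; proj₁; proj₂)
open import Data.Unit using (tt)
open import Relation.Binary.PropositionalEquality using (_≡_; refl; subst)
open import Relation.Binary.Construct.Closure.ReflexiveTransitive using (ε; _◅_)

module _ {S : Sig} (I : Interp S) where

  Do-nil-refl : ∀ {s} → Do I nil s s
  Do-nil-refl = nil , ε , f-test tt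

  Do-nil⇒≡ : ∀ {s s'} → Do I nil s s' → s ≡ s'
  Do-nil⇒≡ (_ , ε , _) = refl
  Do-nil⇒≡ (_ , _◅_ {j = _ , _} () _ , _)

  Trans*-seq⇒Do : ∀ {δ₁ δ₂ δ' s s'} → Trans* I (δ₁ ︔ δ₂) s δ' s' → Final I δ' s' →
                  Σ (Sit S) (λ s₁ → Do I δ₁ s s₁ × Do I δ₂ s₁ s')
  Trans*-seq⇒Do ε (f-seq fin₁ fin₂) = _ , (_ , ε , fin₁) , (_ , ε , fin₂)
  Trans*-seq⇒Do (_◅_ {j = _ , _} (t-seq₁ t) ts) fin
    with Trans*-seq⇒Do ts fin
  ... | s₁ , (δ₁' , ts₁ , fin₁) , do₂ = s₁ , (δ₁' , t ◅ ts₁ , fin₁) , do₂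
  Trans*-seq⇒Do (_◅_ {j = _ , _} (t-seq₂ fin₁ t) ts) fin =
    _ , (_ , ε , fin₁) , (_ , t ◅ ts , fin)

  Do-seq : ∀ {δ₁ δ₂ s s'} → Do I (δ₁ ︔ δ₂) s s' →
           Σ (Sit S) (λ s₁ → Do I δ₁ s s₁ × Do I δ₂ s₁ s')
  Do-seq (_ , ts , fin) = Trans*-seq⇒Do ts fin

doSeq : ∀ {S} → List (Action S) → Sit S → Sit S
doSeq []       s = s
doSeq (α ∷ αs) s = doSeq αs (doₛ α s)

module _ {Sh Sl : Sig} {Dl : BAT Sl} (m : RefMap {Sh} {Sl} Dl) (Il : Interp Sl) where

  Do-mSeq-∷ : ∀ α αs {s s'} → Do Il (mSeq m (α ∷ αs)) s s' →
              Σ (Sit Sl) (λ s₁ → Do Il (mAct m α) s s₁ × Do Il (mSeq m αs) s₁ s')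
  Do-mSeq-∷ α []       d = _ , d , Do-nil-refl Il
  Do-mSeq-∷ α (_ ∷ _)  d = Do-seq Il d

module Bisimulation {Sh Sl : Sig} {Dl : BAT Sl} (m : RefMap {Sh} {Sl} Dl)
  {Ih : Interp Sh} {Il : Interp Sl} {B : Sit Sh → Sit Sl → Set}
  (bisim : IsBisim m Ih Il B) where

  mAct-forward : ∀ α {sh sl} → B sh sl → Poss Ih α sh →
                 Σ (Sit Sl) (λ sl' → Do Il (mAct m α) sl sl' × B (doₛ α sh) sl')
  mAct-forward (A , x) b = proj₁ (proj₂ (bisim _ _ b)) A x

  mAct-backward : ∀ α {sh sl sl'} → B sh sl → Do Il (mAct m α) sl sl' →
                  Poss Ih α sh × B (doₛ α sh) sl'
  mAct-backward (A , x) b = proj₂ (proj₂ (bisim _ _ b)) A x _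

  mSeq-backward : ∀ αs {sh sl sl'} → B sh sl → Do Il (mSeq m αs) sl sl' →
                  B (doSeq αs sh) sl'
  mSeq-backward []       b d = subst (B _) (Do-nil⇒≡ Il d) b
  mSeq-backward (α ∷ αs) b d with Do-mSeq-∷ m Il α αs d
  ... | _ , dα , dαs = mSeq-backward αs (proj₂ (mAct-backward α b dα)) dαs

  mSeq-snoc-backward : ∀ αs β {sh sl sl'} → B sh sl → Do Il (mSeq m (αs ++ β ∷ [])) sl sl' →
                       Σ (Sit Sl) (λ sl₁ → B (doSeq αs sh) sl₁ × Do Il (mAct m β) sl₁ sl')
  mSeq-snoc-backward []       β b d = _ , b , d
  mSeq-snoc-backward (α ∷ αs) β b d with Do-mSeq-∷ m Il α (αs ++ β ∷ []) d
  ... | _ , dα , dαsβ = mSeq-snoc-backward αs β (proj₂ (mAct-backward α b dα)) dαsβ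

theorem3 : ∀ {Sh Sl : Sig} (Dh : BAT Sh) (Dl : BAT Sl) (m : RefMap {Sh} {Sl} Dl) →
    SoundAbstraction m Dh →
    ∀ (αs : List (Action Sh)) (β : Action Sh) →
    ∀ (Il : Interp Sl) → IsModel Dl Il →
    Σ (Sit Sl) (λ s → Do Il (mSeq m (αs ++ β ∷ [])) S₀ s) →
    ∀ (s : Sit Sl) → Do Il (mSeq m αs) S₀ s →
    Σ (Sit Sl) (λ s' → Do Il (mAct m β) s s')
theorem3 Dh Dl m sound αs β Il model (_ , dαsβ) s dαs
  with sound Il model
... | Ih , _ , B , bisim , b₀ =
  let open Bisimulation m bisim
      bαs = mSeq-backward αs b₀ dαs
      _ , b₁ , dβ₁ = mSeq-snoc-backward αs β b₀ dαsβ
      possβ = proj₁ (mAct-backward β b₁ dβ₁)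
      s' , dβ , _ = mAct-forward β bαs possβ
  in s' , dβ
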